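{- Let $t$ be a rational number with $t\notin\{0,\pm\frac15,\pm\frac35,\pm\frac75,\pm\frac7{15}\}$, and let \[ q=\frac{(t-1)(t+1)(25t+7)(25t-7)}{1024\,t^2}. \] Then the triple \[ \left\{1,\ -\frac{625t^4-930t^2+49}{1024\,t^2},\ -\frac{(5t+1)(5t-1)(5t+7)(5t-7)}{1600\,t^2}\right\} \] is a strong rational Diophantine $D(q)$-triple.
   Context: Let $q$ be a rational number. A strong rational Diophantine $D(q)$-triple is a set $\{a,b,c\}$ of three distinct non-zero rational numbers such that $a^2+q$, $b^2+q$, $c^2+q$, $ab+q$, $ac+q$ and $bc+q$ are all squares of rational numbers. -}

module Defs where

open import Data.Integer using (ℤ; +_; -[1+_])
open import Data.Rational using (ℚ; _+_; _*_; _-_; -_; _/_; 0ℚ; 1ℚ; 1/_; ≢-nonZero)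
open import Data.Product using (∃; _×_)
open import Relation.Binary.PropositionalEquality using (_≡_; _≢_)

IsSquareℚ : ℚ → Set
IsSquareℚ x = ∃ λ (r : ℚ) → x ≡ r * r

StrongDTriple : ℚ → ℚ → ℚ → ℚ → Set
StrongDTriple q a b c =
  (a ≢ b × a ≢ c × b ≢ c) ×
  (a ≢ 0ℚ × b ≢ 0ℚ × c ≢ 0ℚ) ×
  IsSquareℚ (a * a + q) × IsSquareℚ (b * b + q) × IsSquareℚ (c * c + q) ×
  IsSquareℚ (a * b + q) × IsSquareℚ (a * c + q) × IsSquareℚ (b * c + q)

r1 r5 r7 r25 r625 r930 r49 : ℚ
r1 = + 1 / 1
r5 = + 5 / 1
r7 = + 7 / 1
r25 = + 25 / 1
r625 = + 625 / 1
r930 = + 930 / 1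
r49 = + 49 / 1

invSq : (t : ℚ) → t ≢ 0ℚ → ℚ
invSq t t≢0 = (1/ t) {{≢-nonZero t≢0}} * (1/ t) {{≢-nonZero t≢0}}

qOf : (t : ℚ) → t ≢ 0ℚ → ℚ
qOf t h = (t - r1) * (t + r1) * (r25 * t + r7) * (r25 * t - r7) * invSq t h * (+ 1 / 1024)

bOf : (t : ℚ) → t ≢ 0ℚ → ℚ
bOf t h = - ((r625 * (t * t * t * t) - r930 * (t * t) + r49) * invSq t h * (+ 1 / 1024))

cOf : (t : ℚ) → t ≢ 0ℚ → ℚ
cOf t h = - ((r5 * t + r1) * (r5 * t - r1) * (r5 * t + r7) * (r5 * t - r7) * invSq t h * (+ 1 / 1600))

-- Each of q, 1, b, c is a polynomial Q, A, B, C in t divided by t², so for x, y in the triple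
-- xy + q = (XY + Q t²) / t⁴, and it suffices that every XY + Q t² is the square of a polynomial.
-- Distinctness and non-vanishing also reduce to the numerators: A = B and A = C would make an even
-- quartic with positive coefficients vanish, B = 0 would make 29 the square of a rational, and
-- C = 0 or B = C would make t a root of a product of four linear factors whose roots are excluded.
module Submission where

open import Defs
open import Data.Integer using (+_; -[1+_])
open import Data.Rational using (ℚ; _/_; 0ℚ; 1ℚ; _+_; _*_; _-_; -_; 1/_; ≢-nonZero; mkℚ; NonNegative; Positive)
open import Data.Rational.Properties
  using ( _≟_; *-identityˡ; *-identityʳ; *-assoc; *-comm; *-zeroˡ; *-zeroʳ; *-inverseˡ; +-inverseʳ
        ; +-0-group; <-irrefl; positive⁻¹; nonNeg*nonNeg⇒nonNeg; nonPos*nonPos⇒nonPos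
        ; nonNeg+nonNeg⇒nonNeg; nonNeg+pos⇒pos; toℚᵘ-homo-*; toℚᵘ-cong; normalize-coprime )
open import Data.Rational.Solver using (module +-*-Solver)
open +-*-Solver using (solve; _:=_; Polynomial; ⟦_⟧; con; var; _:+_; _:*_; _:-_; :-_)
open import Data.Rational.Unnormalised using (*≡*)
open import Data.Rational.Unnormalised.Properties using (≃-trans; ≃-sym)
open import Algebra.Properties.Group +-0-group using (x∙y⁻¹≈ε⇒x≈y)
import Data.Integer as ℤ
import Data.Integer.Properties as ℤP
open import Data.Nat as ℕ using (ℕ; suc)
import Data.Nat.Properties as ℕP
open import Data.Nat.Divisibility using (_∣_; divides; ∣-refl)
import Data.Nat.Coprimality as Coprime
open Coprime using (Coprime)
open import Data.Fin using (zero)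
open import Data.Vec using (_∷_; [])
open import Data.Product using (_,_; ∃-syntax)
open import Data.Sum using (_⊎_; inj₁; inj₂; [_,_]′)
open import Relation.Nullary using (yes; no)
open import Relation.Binary.PropositionalEquality using (_≡_; _≢_; refl; sym; trans; cong; cong₂; subst; module ≡-Reasoning)
open ≡-Reasoning

x*y≡0⇒x≡0⊎y≡0 : ∀ x y → x * y ≡ 0ℚ → x ≡ 0ℚ ⊎ y ≡ 0ℚ
x*y≡0⇒x≡0⊎y≡0 x y xy≡0 with x ≟ 0ℚ
... | yes x≡0 = inj₁ x≡0
... | no  x≢0 = inj₂ (begin
  y              ≡⟨ sym (*-identityˡ y) ⟩
  1ℚ * y         ≡⟨ cong (_* y) (sym (*-inverseˡ x)) ⟩
  1/ x * x * y   ≡⟨ *-assoc (1/ x) x y ⟩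
  1/ x * (x * y) ≡⟨ cong (1/ x *_) xy≡0 ⟩
  1/ x * 0ℚ      ≡⟨ *-zeroʳ (1/ x) ⟩
  0ℚ             ∎)
  where instance _ = ≢-nonZero x≢0

roots-of-quartic : ∀ {t a b c d} → (t - a) * (t - b) * (t - c) * (t - d) ≡ 0ℚ →
                   t ≡ a ⊎ t ≡ b ⊎ t ≡ c ⊎ t ≡ d
roots-of-quartic {t} {a} {b} {c} {d} p with x*y≡0⇒x≡0⊎y≡0 _ _ p
... | inj₂ t-d≡0 = inj₂ (inj₂ (inj₂ (x∙y⁻¹≈ε⇒x≈y t d t-d≡0)))
... | inj₁ p₃ with x*y≡0⇒x≡0⊎y≡0 _ _ p₃
...   | inj₂ t-c≡0 = inj₂ (inj₂ (inj₁ (x∙y⁻¹≈ε⇒x≈y t c t-c≡0)))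
...   | inj₁ p₂ with x*y≡0⇒x≡0⊎y≡0 _ _ p₂
...     | inj₁ t-a≡0 = inj₁ (x∙y⁻¹≈ε⇒x≈y t a t-a≡0)
...     | inj₂ t-b≡0 = inj₂ (inj₁ (x∙y⁻¹≈ε⇒x≈y t b t-b≡0))

x≡y⇒k*[x-y]≡0 : ∀ {x y} k → x ≡ y → k * (x - y) ≡ 0ℚ
x≡y⇒k*[x-y]≡0 {x} k refl = trans (cong (k *_) (+-inverseʳ x)) (*-zeroʳ k)

-- nonPos*nonPos⇒nonPos concludes NonNegative, despite its name.
x*x-nonNeg : ∀ x → NonNegative (x * x)
x*x-nonNeg x@(mkℚ (+ _)    _ _) = nonNeg*nonNeg⇒nonNeg x x
x*x-nonNeg x@(mkℚ -[1+ _ ] _ _) = nonPos*nonPos⇒nonPos x x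

even-quartic≢0 : ∀ a b c t → .{{NonNegative a}} → .{{NonNegative b}} → .{{Positive c}} →
                 a * (t * t * (t * t)) + b * (t * t) + c ≢ 0ℚ
even-quartic≢0 a b c t p≡0 = <-irrefl (sym p≡0) (positive⁻¹ _ {{positivity}})
  where
  positivity : Positive (a * (t * t * (t * t)) + b * (t * t) + c)
  positivity = nonNeg+pos⇒pos (a * (t * t * (t * t)) + b * (t * t)) c
    where instance
      _ = x*x-nonNeg t
      _ = x*x-nonNeg (t * t)
      _ = nonNeg*nonNeg⇒nonNeg a (t * t * (t * t))
      _ = nonNeg*nonNeg⇒nonNeg b (t * t)
      _ = nonNeg+nonNeg⇒nonNeg (a * (t * t * (t * t))) (b * (t * t))

x*x≡n⇒perfectSquare : ∀ x n → x * x ≡ + n / 1 → ∃[ m ] m ℕ.* m ≡ n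
x*x≡n⇒perfectSquare x@(mkℚ num d-1 num⊥d) n x*x≡n
  with ≃-trans (≃-sym (toℚᵘ-homo-* x x)) (toℚᵘ-cong (trans x*x≡n (normalize-coprime n⊥1)))
  where n⊥1 = Coprime.sym (Coprime.1-coprimeTo n)
... | *≡* num²≡nD² = m , (begin
  m ℕ.* m          ≡⟨ m*m≡n*D*D ⟩
  n ℕ.* (D ℕ.* D)  ≡⟨ cong (λ k → n ℕ.* (k ℕ.* k)) D≡1 ⟩
  n ℕ.* 1          ≡⟨ ℕP.*-identityʳ n ⟩
  n                ∎)
  where
  m D : ℕ
  m = ℤ.∣ num ∣
  D = suc d-1
  m*m≡n*D*D : m ℕ.* m ≡ n ℕ.* (D ℕ.* D)
  m*m≡n*D*D = trans (sym (ℤP.abs-* num num))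
                (trans (cong ℤ.∣_∣ (trans (sym (ℤP.*-identityʳ (num ℤ.* num))) num²≡nD²))
                       (ℤP.abs-* (+ n) (+ (D ℕ.* D))))
  m⊥D : Coprime m D
  m⊥D = Coprime.recompute num⊥d
  D∣m : D ∣ m
  D∣m = Coprime.coprime-divisor (Coprime.sym m⊥D)
          (divides (n ℕ.* D) (trans m*m≡n*D*D (sym (ℕP.*-assoc n D D))))
  D≡1 : D ≡ 1
  D≡1 = m⊥D (D∣m , ∣-refl)

m*m≢29 : ∀ m → m ℕ.* m ≢ 29
m*m≢29 0 ()
m*m≢29 1 ()
m*m≢29 2 ()
m*m≢29 3 ()
m*m≢29 4 ()
m*m≢29 5 ()
m*m≢29 m@(suc (suc (suc (suc (suc (suc k)))))) m*m≡29 =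
  ℕP.≤⇒≯ (subst (36 ℕ.≤_) m*m≡29 (ℕP.*-mono-≤ 6≤m 6≤m)) (ℕP.m<n+m 29 {7} ℕ.z<s)
  where
  6≤m : 6 ℕ.≤ m
  6≤m = ℕP.m≤m+n 6 k

x*x≢29 : ∀ x → x * x ≢ + 29 / 1
x*x≢29 x x*x≡29 with x*x≡n⇒perfectSquare x 29 x*x≡29
... | m , m*m≡29 = m*m≢29 m m*m≡29

module OverDenominator {u d : ℚ} (u*d≡1 : u * d ≡ 1ℚ) where

  -- A record rather than the bare equation x ≡ X * u, so that the numerator X can be recovered
  -- by unification (ℚ's _*_ always computes, so X * u cannot be matched against).
  infix 4 _≡_/d
  record _≡_/d (x X : ℚ) : Set where
    constructor by
    field x≡X*u : x ≡ X * u

  numerators-≡ : ∀ {x y X Y} → x ≡ X /d → y ≡ Y /d → x ≡ y → X ≡ Y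
  numerators-≡ {X = X} {Y} (by x≡X*u) (by y≡Y*u) x≡y = begin
    X            ≡⟨ sym (*-identityʳ X) ⟩
    X * 1ℚ       ≡⟨ cong (X *_) (sym u*d≡1) ⟩
    X * (u * d)  ≡⟨ sym (*-assoc X u d) ⟩
    X * u * d    ≡⟨ cong (_* d) (trans (sym x≡X*u) (trans x≡y y≡Y*u)) ⟩
    Y * u * d    ≡⟨ *-assoc Y u d ⟩
    Y * (u * d)  ≡⟨ cong (Y *_) u*d≡1 ⟩
    Y * 1ℚ       ≡⟨ *-identityʳ Y ⟩
    Y            ∎

  square : ∀ {x y q X Y Q} → x ≡ X /d → y ≡ Y /d → q ≡ Q /d →
           IsSquareℚ (X * Y + Q * d) → IsSquareℚ (x * y + q)
  square {X = X} {Y} {Q} (by refl) (by refl) (by refl) (R , XY+Qd≡R²) = R * u , (begin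
    X * u * (Y * u) + Q * u            ≡⟨ cong (λ z → X * u * (Y * u) + z) (sym (*-identityʳ (Q * u))) ⟩
    X * u * (Y * u) + Q * u * 1ℚ       ≡⟨ cong (λ z → X * u * (Y * u) + Q * u * z) (sym u*d≡1) ⟩
    X * u * (Y * u) + Q * u * (u * d)  ≡⟨ solve 5 (λ X Y Q u d → X :* u :* (Y :* u) :+ Q :* u :* (u :* d)
                                                          := (X :* Y :+ Q :* d) :* (u :* u)) refl X Y Q u d ⟩
    (X * Y + Q * d) * (u * u)          ≡⟨ cong (_* (u * u)) XY+Qd≡R² ⟩
    R * R * (u * u)                    ≡⟨ solve 2 (λ R u → R :* R :* (u :* u) := R :* u :* (R :* u)) refl R u ⟩
    R * u * (R * u)                    ∎)

-- The numerators are written once, as solver syntax in one variable: ⟦_⟧₁ reads them as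
-- functions of t, and the identities below are `solve` applied to the very same expressions.
-- q̂, b̂, ĉ are the polynomial factors in qOf, bOf, cOf.
q̂ b̂ ĉ Â Q̂ B̂ Ĉ : ∀ {n} → Polynomial n → Polynomial n
q̂ t = (t :- con r1) :* (t :+ con r1) :* (con r25 :* t :+ con r7) :* (con r25 :* t :- con r7)
b̂ t = con r625 :* (t :* t :* t :* t) :- con r930 :* (t :* t) :+ con r49
ĉ t = (con r5 :* t :+ con r1) :* (con r5 :* t :- con r1) :* (con r5 :* t :+ con r7) :* (con r5 :* t :- con r7)
Â t = t :* t
Q̂ t = q̂ t :* con (+ 1 / 1024)
B̂ t = :- (b̂ t :* con (+ 1 / 1024))
Ĉ t = :- (ĉ t :* con (+ 1 / 1600))

⟦_⟧₁ : (∀ {n} → Polynomial n → Polynomial n) → ℚ → ℚ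
⟦ p ⟧₁ t = ⟦ p (var zero) ⟧ (t ∷ [])

A Q B C : ℚ → ℚ
A = ⟦ Â ⟧₁
Q = ⟦ Q̂ ⟧₁
B = ⟦ B̂ ⟧₁
C = ⟦ Ĉ ⟧₁

square-AA : ∀ t → IsSquareℚ (A t * A t + Q t * (t * t))
square-AA t = ⟦ R̂ ⟧₁ t , solve 1 (λ t → Â t :* Â t :+ Q̂ t :* (t :* t) := R̂ t :* R̂ t) refl t
  where
  R̂ : ∀ {n} → Polynomial n → Polynomial n
  R̂ t = t :* (con r25 :* (t :* t) :+ con r7) :* con (+ 1 / 32)

square-BB : ∀ t → IsSquareℚ (B t * B t + Q t * (t * t))
square-BB t = ⟦ R̂ ⟧₁ t , solve 1 (λ t → B̂ t :* B̂ t :+ Q̂ t :* (t :* t) := R̂ t :* R̂ t) refl t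
  where
  R̂ : ∀ {n} → Polynomial n → Polynomial n
  R̂ t = (con r625 :* (t :* t :* (t :* t)) :- con (+ 418 / 1) :* (t :* t) :+ con r49) :* con (+ 1 / 1024)

square-CC : ∀ t → IsSquareℚ (C t * C t + Q t * (t * t))
square-CC t = ⟦ R̂ ⟧₁ t , solve 1 (λ t → Ĉ t :* Ĉ t :+ Q̂ t :* (t :* t) := R̂ t :* R̂ t) refl t
  where
  R̂ : ∀ {n} → Polynomial n → Polynomial n
  R̂ t = (con r625 :* (t :* t :* (t :* t)) :- con r49) :* con (+ 1 / 1600)

square-AB : ∀ t → IsSquareℚ (A t * B t + Q t * (t * t))
square-AB t = ⟦ R̂ ⟧₁ t , solve 1 (λ t → Â t :* B̂ t :+ Q̂ t :* (t :* t) := R̂ t :* R̂ t) refl t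
  where
  R̂ : ∀ {n} → Polynomial n → Polynomial n
  R̂ t = t :* t :* con (+ 1 / 2)

square-AC : ∀ t → IsSquareℚ (A t * C t + Q t * (t * t))
square-AC t = ⟦ R̂ ⟧₁ t , solve 1 (λ t → Â t :* Ĉ t :+ Q̂ t :* (t :* t) := R̂ t :* R̂ t) refl t
  where
  R̂ : ∀ {n} → Polynomial n → Polynomial n
  R̂ t = t :* (con (+ 75 / 1) :* (t :* t) :+ con (+ 21 / 1)) :* con (+ 1 / 160)

square-BC : ∀ t → IsSquareℚ (B t * C t + Q t * (t * t))
square-BC t = ⟦ R̂ ⟧₁ t , solve 1 (λ t → B̂ t :* Ĉ t :+ Q̂ t :* (t :* t) := R̂ t :* R̂ t) refl t
  where
  R̂ : ∀ {n} → Polynomial n → Polynomial n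
  R̂ t = (con r625 :* (t :* t :* (t :* t)) :- con (+ 290 / 1) :* (t :* t) :+ con r49) :* con (+ 1 / 1280)

A-B-as-even-quartic : ∀ t → r625 * (t * t * (t * t)) + + 94 / 1 * (t * t) + r49 ≡ + 1024 / 1 * (A t - B t)
A-B-as-even-quartic = solve 1 (λ t → con r625 :* (t :* t :* (t :* t)) :+ con (+ 94 / 1) :* (t :* t) :+ con r49
                                     := con (+ 1024 / 1) :* (Â t :- B̂ t)) refl

A-C-as-even-quartic : ∀ t → r625 * (t * t * (t * t)) + + 350 / 1 * (t * t) + r49 ≡ + 1600 / 1 * (A t - C t)
A-C-as-even-quartic = solve 1 (λ t → con r625 :* (t :* t :* (t :* t)) :+ con (+ 350 / 1) :* (t :* t) :+ con r49
                                     := con (+ 1600 / 1) :* (Â t :- Ĉ t)) refl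

B-as-square-minus-29 : ∀ t → let w = + 125 / 16 * (t * t) - + 93 / 16 in
                       w * w - + 29 / 1 ≡ -[1+ 99 ] / 1 * (B t - 0ℚ)
B-as-square-minus-29 = solve 1 (λ t → let w = con (+ 125 / 16) :* (t :* t) :- con (+ 93 / 16) in
                                      w :* w :- con (+ 29 / 1) := con (-[1+ 99 ] / 1) :* (B̂ t :- con 0ℚ)) refl

C-factorisation : ∀ t → (t - + 1 / 5) * (t - -[1+ 0 ] / 5) * (t - + 7 / 5) * (t - -[1+ 6 ] / 5)
                        ≡ -[1+ 63 ] / 25 * (C t - 0ℚ)
C-factorisation = solve 1 (λ t → (t :- con (+ 1 / 5)) :* (t :- con (-[1+ 0 ] / 5)) :* (t :- con (+ 7 / 5))
                                 :* (t :- con (-[1+ 6 ] / 5)) := con (-[1+ 63 ] / 25) :* (Ĉ t :- con 0ℚ)) refl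

B-C-factorisation : ∀ t → (t - + 3 / 5) * (t - -[1+ 2 ] / 5) * (t - + 7 / 15) * (t - -[1+ 6 ] / 15)
                          ≡ -[1+ 1023 ] / 225 * (B t - C t)
B-C-factorisation = solve 1 (λ t → (t :- con (+ 3 / 5)) :* (t :- con (-[1+ 2 ] / 5)) :* (t :- con (+ 7 / 15))
                                   :* (t :- con (-[1+ 6 ] / 15)) := con (-[1+ 1023 ] / 225) :* (B̂ t :- Ĉ t)) refl

p*u*k≡p*k*u : ∀ p u k → p * u * k ≡ p * k * u
p*u*k≡p*k*u = solve 3 (λ p u k → p :* u :* k := p :* k :* u) refl

-[p*u*k]≡-[p*k]*u : ∀ p u k → - (p * u * k) ≡ - (p * k) * u
-[p*u*k]≡-[p*k]*u = solve 3 (λ p u k → :- (p :* u :* k) := :- (p :* k) :* u) refl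

module OverT² (t : ℚ) (t≢0 : t ≢ 0ℚ) where
  private
    instance _ = ≢-nonZero t≢0

  invSq*t²≡1 : invSq t t≢0 * (t * t) ≡ 1ℚ
  invSq*t²≡1 = begin
    1/ t * 1/ t * (t * t)  ≡⟨ solve 2 (λ s t → s :* s :* (t :* t) := s :* t :* (s :* t)) refl (1/ t) t ⟩
    1/ t * t * (1/ t * t)  ≡⟨ cong₂ _*_ (*-inverseˡ t) (*-inverseˡ t) ⟩
    1ℚ                     ∎

  open OverDenominator {invSq t t≢0} {t * t} invSq*t²≡1 public

  1≡A/t² : 1ℚ ≡ A t /d
  1≡A/t² = by (sym (trans (*-comm (t * t) (invSq t t≢0)) invSq*t²≡1))

  q≡Q/t² : qOf t t≢0 ≡ Q t /d
  q≡Q/t² = by (p*u*k≡p*k*u (⟦ q̂ ⟧₁ t) (invSq t t≢0) (+ 1 / 1024))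

  b≡B/t² : bOf t t≢0 ≡ B t /d
  b≡B/t² = by (-[p*u*k]≡-[p*k]*u (⟦ b̂ ⟧₁ t) (invSq t t≢0) (+ 1 / 1024))

  c≡C/t² : cOf t t≢0 ≡ C t /d
  c≡C/t² = by (-[p*u*k]≡-[p*k]*u (⟦ ĉ ⟧₁ t) (invSq t t≢0) (+ 1 / 1600))

  0≡0/t² : 0ℚ ≡ 0ℚ /d
  0≡0/t² = by (sym (*-zeroˡ (invSq t t≢0)))

proposition3 : (t : ℚ) → (h0 : t ≢ 0ℚ) →
    t ≢ + 1 / 5 → t ≢ -[1+ 0 ] / 5 →
    t ≢ + 3 / 5 → t ≢ -[1+ 2 ] / 5 →
    t ≢ + 7 / 5 → t ≢ -[1+ 6 ] / 5 →
    t ≢ + 7 / 15 → t ≢ -[1+ 6 ] / 15 →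
    StrongDTriple (qOf t h0) 1ℚ (bOf t h0) (cOf t h0)
proposition3 t t≢0 t≢1/5 t≢-1/5 t≢3/5 t≢-3/5 t≢7/5 t≢-7/5 t≢7/15 t≢-7/15 =
    (a≢b , a≢c , b≢c)
  , ((λ ()) , b≢0 , c≢0)
  , square 1≡A/t² 1≡A/t² q≡Q/t² (square-AA t)
  , square b≡B/t² b≡B/t² q≡Q/t² (square-BB t)
  , square c≡C/t² c≡C/t² q≡Q/t² (square-CC t)
  , square 1≡A/t² b≡B/t² q≡Q/t² (square-AB t)
  , square 1≡A/t² c≡C/t² q≡Q/t² (square-AC t)
  , square b≡B/t² c≡C/t² q≡Q/t² (square-BC t)
  where
  open OverT² t t≢0

  a≢b : 1ℚ ≢ bOf t t≢0
  a≢b a≡b = even-quartic≢0 r625 (+ 94 / 1) r49 t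
    (trans (A-B-as-even-quartic t) (x≡y⇒k*[x-y]≡0 (+ 1024 / 1) (numerators-≡ 1≡A/t² b≡B/t² a≡b)))
  a≢c : 1ℚ ≢ cOf t t≢0
  a≢c a≡c = even-quartic≢0 r625 (+ 350 / 1) r49 t
    (trans (A-C-as-even-quartic t) (x≡y⇒k*[x-y]≡0 (+ 1600 / 1) (numerators-≡ 1≡A/t² c≡C/t² a≡c)))
  b≢0 : bOf t t≢0 ≢ 0ℚ
  b≢0 b≡0 = x*x≢29 (+ 125 / 16 * (t * t) - + 93 / 16) (x∙y⁻¹≈ε⇒x≈y _ _
    (trans (B-as-square-minus-29 t) (x≡y⇒k*[x-y]≡0 (-[1+ 99 ] / 1) (numerators-≡ b≡B/t² 0≡0/t² b≡0))))
  c≢0 : cOf t t≢0 ≢ 0ℚ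
  c≢0 c≡0 = [ t≢1/5 , [ t≢-1/5 , [ t≢7/5 , t≢-7/5 ]′ ]′ ]′ (roots-of-quartic
    (trans (C-factorisation t) (x≡y⇒k*[x-y]≡0 (-[1+ 63 ] / 25) (numerators-≡ c≡C/t² 0≡0/t² c≡0))))
  b≢c : bOf t t≢0 ≢ cOf t t≢0
  b≢c b≡c = [ t≢3/5 , [ t≢-3/5 , [ t≢7/15 , t≢-7/15 ]′ ]′ ]′ (roots-of-quartic
    (trans (B-C-factorisation t) (x≡y⇒k*[x-y]≡0 (-[1+ 1023 ] / 225) (numerators-≡ b≡B/t² c≡C/t² b≡c))))
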